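{- Let $V$ be a ground set of $n$ elements with $n$ even, let $\varepsilon>0$ with $\varepsilon^2=\frac1n\cdot\omega(\ln n)$, and let $\beta=\frac n4(1+\varepsilon)$ be an integer. For $R\subseteq V$ define $f_1(S)=\min\left(|S|,\frac n2\right)-\frac{|S|}{2}$ and $f_2(S)=\min\left(|S|,\frac n2,\beta+|S\cap R|,\beta+|S\cap (V\setminus R)|\right)-\frac{|S|}{2}$. Fix an arbitrary subset $S\subseteq V$, and then let $R$ be a uniformly random subset of $V$ of size $\frac n2$. Then the probability (over the choice of $R$) that $f_1(S)\ne f_2(S)$ is at most $n^{ -\omega(1)}$.
   Context: A quantity is $n^{ -\omega(1)}$ if for every constant $a>0$ it is at most $n^{ -a}$ for all sufficiently large $n$. -}

module Defs where

open import Data.Nat as ℕ using (ℕ; zero; suc; _+_; _*_)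
open import Data.Nat.DivMod using (_/_)
open import Data.Integer using (+_)
open import Data.Rational as ℚ using (ℚ; _⊓_; _-_)
open import Data.Rational.Properties using (_≟_)
open import Data.Bool using (Bool; true; false)
open import Data.Vec using (Vec; []; _∷_)
open import Data.List using (List; []; _∷_; map; _++_; filter; length)
open import Data.Fin.Subset using (Subset; ∣_∣; _∩_; ∁)
open import Relation.Nullary using (¬_; ¬?)
open import Relation.Binary.PropositionalEquality using (_≡_)
open import Relation.Nullary.Decidable using (_×-dec_)

allSubsets : (n : ℕ) → List (Subset n)
allSubsets zero = [] ∷ []
allSubsets (suc n) = map (false ∷_) (allSubsets n) ++ map (true ∷_) (allSubsets n)

⟦_⟧ : ℕ → ℚ
⟦ k ⟧ = (+ k) ℚ./ 1

half : ℕ → ℚ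
half k = (+ k) ℚ./ 2

f₁ : {n : ℕ} → Subset n → ℚ
f₁ {n} S = (⟦ ∣ S ∣ ⟧ ⊓ half n) - half ∣ S ∣

f₂ : {n : ℕ} → (β : ℕ) → (R : Subset n) → Subset n → ℚ
f₂ {n} β R S =
  (⟦ ∣ S ∣ ⟧ ⊓ half n ⊓ ⟦ β + ∣ S ∩ R ∣ ⟧ ⊓ ⟦ β + ∣ S ∩ ∁ R ∣ ⟧) - half ∣ S ∣

badCount : (n β : ℕ) → Subset n → ℕ
badCount n β S =
  length (filter (λ R → (∣ R ∣ ℕ.≟ n / 2) ×-dec ¬? (f₁ S ≟ f₂ β R S)) (allSubsets n))

module Submission where

open import Defs
open import Data.Nat using (ℕ; _+_; _*_; _∸_; _^_; _≤_; _<_)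
open import Data.Nat.DivMod using (_/_)
open import Data.Nat.Divisibility using (_∣_)
open import Data.Nat.Combinatorics using (_C_)
open import Data.Nat.Logarithm using (⌊log₂_⌋)
open import Data.Fin.Subset using (Subset)
open import Data.Product using (∃)

-- Write 4β = n + D; the hypotheses say D² ≥ C n log n for every
-- C once n is large.
-- (1) Deterministically, f₁(S) ≠ f₂(S) forces one side of R to hold noticeably
--     more than half of S: 4|S ∩ R| > 2|S| + D or 4|S ∖ R| > 2|S| + D
--     (disagreement⇒deviation).
-- (2) We count such R among ALL 2^n subsets, dropping |R| = n/2, by the
--     exponential moment method with integer weights: R weighs
--     a^|S∩R| b^|S∖R|, the total weight is (a + b)^|S| 2^(n-|S|) (weight-sum),
--     and for a = Q + 1, b = Q - 1 with Q = 2⌊D/8(E+1)⌋, where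
--     2^E ≥ (n + 1) 2nᴬ, every large deviation weighs at least Q^|S| (n + 1) 2nᴬ
--     (deviation-weights, from elementary Bernoulli inequalities).  Markov's
--     inequality bounds both tail counts by 2^n / ((n + 1) 2nᴬ)
--     (deviation-counts).
-- (3) As 2^n ≤ (n + 1) C(n, n/2) (central-binomial), at most C(n, n/2) / nᴬ
--     subsets R of size n/2 are bad, which is lemma4.

open import Data.Nat using (zero; suc; z≤n; s≤s; _≤?_; _<?_; NonZero; _!)
import Data.Nat as ℕ
open import Data.Nat.Properties
open import Data.Nat.DivMod using (_%_; m/n*n≡m; m*n/n≡m; m/n*n≤m; /-monoˡ-≤; m≡m%n+[m/n]*n; m%n<n)
open import Data.Nat.Divisibility using (divides)
open import Data.Nat.Combinatorics using (nCk≡n!/k![n-k]!; k![n∸k]!∣n!)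
open import Data.Nat.Logarithm using (⌊log₂⌋-mono-≤; ⌊log₂[2^n]⌋≡n)
open import Data.Nat.ListAction using (sum)
open import Data.Nat.ListAction.Properties using (sum-++)
open import Data.Nat.Tactic.RingSolver using (solve-∀; solve)
open import Algebra.Properties.CommutativeSemigroup *-commutativeSemigroup
  using (x∙yz≈y∙xz; xy∙z≈y∙xz; interchange)
import Data.Integer as ℤ
import Data.Integer.Properties as ℤ
open import Data.Rational as ℚ using (_⊓_; _-_; fromℚᵘ)
import Data.Rational.Properties as ℚ
open import Data.Rational.Unnormalised as ℚᵘ using (ℚᵘ; mkℚᵘ; *≤*)
import Data.Rational.Unnormalised.Properties as ℚᵘ
open import Data.Bool using (true; false)
open import Data.List using (List; []; _∷_; _++_; map; filter; length)
open import Data.List.Properties using (filter-accept; filter-reject; map-++; map-∘)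
open import Data.Fin.Subset using (∣_∣; _∩_; ∁)
open import Data.Fin.Subset.Properties using (∣p∣≤n)
open import Data.Product using (Σ; _×_; _,_; proj₁; proj₂)
open import Data.Sum using (_⊎_; inj₁; inj₂)
open import Data.Empty using (⊥-elim)
open import Level using (Level)
open import Relation.Nullary using (¬_; Dec; yes; no)
open import Relation.Unary using (Pred; Decidable)
open import Relation.Binary.PropositionalEquality

fraction-≤ : ∀ a b c d → a * suc d ≤ b * suc c →
             fromℚᵘ (mkℚᵘ (ℤ.+ a) c) ℚ.≤ fromℚᵘ (mkℚᵘ (ℤ.+ b) d)
fraction-≤ a b c d le = ℚ.toℚᵘ-cancel-≤
  (ℚᵘ.≤-respˡ-≃ (ℚᵘ.≃-sym (ℚ.toℚᵘ-fromℚᵘ p)) (ℚᵘ.≤-respʳ-≃ (ℚᵘ.≃-sym (ℚ.toℚᵘ-fromℚᵘ q))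
    (*≤* (subst₂ ℤ._≤_ (ℤ.pos-* a (suc d)) (ℤ.pos-* b (suc c)) (ℤ.+≤+ le)))))
  where
  p q : ℚᵘ
  p = mkℚᵘ (ℤ.+ a) c
  q = mkℚᵘ (ℤ.+ b) d

-- If n + 2s ≤ 4t then min(s, n/2) ≤ t: when 2s ≤ n we get 4s ≤ n + 2s ≤ 4t,
-- otherwise 2n < n + 2s ≤ 4t.
min-half-≤ : ∀ s n t → n + 2 * s ≤ 4 * t → ⟦ s ⟧ ⊓ half n ℚ.≤ ⟦ t ⟧
min-half-≤ s n t le with 2 * s ≤? n
... | yes 2s≤n = ℚ.≤-trans (ℚ.p⊓q≤p ⟦ s ⟧ (half n))
  (fraction-≤ s t 0 0 (*-monoˡ-≤ 1 (*-cancelˡ-≤ {s} {t} 4 (begin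
    4 * s          ≡⟨ solve (s ∷ []) ⟩
    2 * s + 2 * s  ≤⟨ +-monoˡ-≤ (2 * s) 2s≤n ⟩
    n + 2 * s      ≤⟨ le ⟩
    4 * t          ∎))))
  where open ≤-Reasoning
... | no 2s≰n = ℚ.≤-trans (ℚ.p⊓q≤q ⟦ s ⟧ (half n))
  (fraction-≤ n t 1 0 (*-cancelˡ-≤ {n * 1} {t * 2} 2 (begin
    2 * (n * 1)    ≡⟨ solve (n ∷ []) ⟩
    n + n          ≤⟨ +-monoʳ-≤ n (<⇒≤ (≰⇒> 2s≰n)) ⟩
    n + 2 * s      ≤⟨ le ⟩
    4 * t          ≡⟨ solve (t ∷ []) ⟩
    2 * (t * 2)    ∎)))
  where open ≤-Reasoning

⊓-absorbs : ∀ x y z w → x ⊓ y ℚ.≤ z → x ⊓ y ℚ.≤ w → x ⊓ y ⊓ z ⊓ w ≡ x ⊓ y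
⊓-absorbs x y z w xy≤z xy≤w =
  trans (cong (_⊓ w) (ℚ.p≤q⇒p⊓q≡p xy≤z)) (ℚ.p≤q⇒p⊓q≡p xy≤w)

cap-large : ∀ n β D s k j → 4 * β ≡ n + D → k + j ≡ s → 4 * j ≤ 2 * s + D →
            n + 2 * s ≤ 4 * (β + k)
cap-large n β D _ k j eβ refl hj = +-cancelʳ-≤ (4 * j) _ _ (begin
  n + 2 * (k + j) + 4 * j            ≤⟨ +-monoʳ-≤ (n + 2 * (k + j)) hj ⟩
  n + 2 * (k + j) + (2 * (k + j) + D) ≡⟨ solve (n ∷ k ∷ j ∷ D ∷ []) ⟩
  (n + D) + 4 * k + 4 * j            ≡⟨ cong (λ x → x + 4 * k + 4 * j) (sym eβ) ⟩
  4 * β + 4 * k + 4 * j              ≡⟨ solve (β ∷ k ∷ j ∷ []) ⟩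
  4 * (β + k) + 4 * j                ∎)
  where open ≤-Reasoning

module _ where
  open import Data.Vec using ([]; _∷_)

  split-card : ∀ {n} (S R : Subset n) → ∣ S ∩ R ∣ + ∣ S ∩ ∁ R ∣ ≡ ∣ S ∣
  split-card []          []          = refl
  split-card (true ∷ S)  (true ∷ R)  = cong suc (split-card S R)
  split-card (true ∷ S)  (false ∷ R) = trans (+-suc _ _) (cong suc (split-card S R))
  split-card (false ∷ S) (true ∷ R)  = split-card S R
  split-card (false ∷ S) (false ∷ R) = split-card S R

split-card′ : ∀ {n} (S R : Subset n) → ∣ S ∩ ∁ R ∣ + ∣ S ∩ R ∣ ≡ ∣ S ∣
split-card′ S R = trans (+-comm ∣ S ∩ ∁ R ∣ ∣ S ∩ R ∣) (split-card S R)

disagreement⇒deviation : ∀ n β D (S R : Subset n) → 4 * β ≡ n + D →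
  f₁ S ≢ f₂ β R S → 2 * ∣ S ∣ + D < 4 * ∣ S ∩ R ∣ ⊎ 2 * ∣ S ∣ + D < 4 * ∣ S ∩ ∁ R ∣
disagreement⇒deviation n β D S R eβ f₁≢f₂
  with 2 * ∣ S ∣ + D <? 4 * ∣ S ∩ R ∣ | 2 * ∣ S ∣ + D <? 4 * ∣ S ∩ ∁ R ∣
... | yes inside | _          = inj₁ inside
... | no _       | yes outside = inj₂ outside
... | no inside  | no outside = ⊥-elim (f₁≢f₂ (cong (_- half s) (sym
  (⊓-absorbs ⟦ s ⟧ (half n) ⟦ β + k ⟧ ⟦ β + j ⟧
    (min-half-≤ s n (β + k) (cap-large n β D s k j eβ (split-card S R) (≮⇒≥ outside)))
    (min-half-≤ s n (β + j) (cap-large n β D s j k eβ (split-card′ S R) (≮⇒≥ inside)))))))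
  where
  s = ∣ S ∣
  k = ∣ S ∩ R ∣
  j = ∣ S ∩ ∁ R ∣

module _ {a p : Level} {A : Set a} where

  count : {P : Pred A p} → Decidable P → List A → ℕ
  count P? xs = length (filter P? xs)

  count-≤-∷ : {P : Pred A p} (P? : Decidable P) → ∀ x xs → count P? xs ≤ count P? (x ∷ xs)
  count-≤-∷ P? x xs with P? x
  ... | yes _ = n≤1+n _
  ... | no  _ = ≤-refl

  count-yes : {P : Pred A p} (P? : Decidable P) → ∀ {x} xs → P x → count P? (x ∷ xs) ≡ suc (count P? xs)
  count-yes P? xs px = cong length (filter-accept P? px)

  count-no : {P : Pred A p} (P? : Decidable P) → ∀ {x} xs → ¬ P x → count P? (x ∷ xs) ≡ count P? xs
  count-no P? xs ¬px = cong length (filter-reject P? ¬px)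

  count-union : {P Q Q′ : Pred A p} (P? : Decidable P) (Q? : Decidable Q) (Q′? : Decidable Q′) →
    (∀ x → P x → Q x ⊎ Q′ x) → ∀ xs → count P? xs ≤ count Q? xs + count Q′? xs
  count-union P? Q? Q′? cover [] = z≤n
  count-union {P} P? Q? Q′? cover (x ∷ xs) = step (P? x)
    where
    open ≤-Reasoning
    IH : count P? xs ≤ count Q? xs + count Q′? xs
    IH = count-union P? Q? Q′? cover xs
    step : Dec (P x) → count P? (x ∷ xs) ≤ count Q? (x ∷ xs) + count Q′? (x ∷ xs)
    step (no ¬px) = begin
      count P? (x ∷ xs)                      ≡⟨ count-no P? xs ¬px ⟩
      count P? xs                            ≤⟨ IH ⟩
      count Q? xs + count Q′? xs             ≤⟨ +-mono-≤ (count-≤-∷ Q? x xs) (count-≤-∷ Q′? x xs) ⟩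
      count Q? (x ∷ xs) + count Q′? (x ∷ xs) ∎
    step (yes px) with cover x px
    ... | inj₁ qx = begin
      count P? (x ∷ xs)                      ≡⟨ count-yes P? xs px ⟩
      suc (count P? xs)                      ≤⟨ s≤s IH ⟩
      suc (count Q? xs + count Q′? xs)       ≤⟨ s≤s (+-monoʳ-≤ (count Q? xs) (count-≤-∷ Q′? x xs)) ⟩
      suc (count Q? xs) + count Q′? (x ∷ xs) ≡⟨ cong (_+ count Q′? (x ∷ xs)) (count-yes Q? xs qx) ⟨
      count Q? (x ∷ xs) + count Q′? (x ∷ xs) ∎
    ... | inj₂ q′x = begin
      count P? (x ∷ xs)                      ≡⟨ count-yes P? xs px ⟩
      suc (count P? xs)                      ≤⟨ s≤s IH ⟩
      suc (count Q? xs + count Q′? xs)       ≤⟨ s≤s (+-monoˡ-≤ (count Q′? xs) (count-≤-∷ Q? x xs)) ⟩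
      suc (count Q? (x ∷ xs) + count Q′? xs) ≡⟨ +-suc (count Q? (x ∷ xs)) (count Q′? xs) ⟨
      count Q? (x ∷ xs) + suc (count Q′? xs) ≡⟨ cong (count Q? (x ∷ xs) +_) (count-yes Q′? xs q′x) ⟨
      count Q? (x ∷ xs) + count Q′? (x ∷ xs) ∎

  markov : {P : Pred A p} (P? : Decidable P) (g : A → ℕ) (w : ℕ) →
    (∀ x → P x → w ≤ g x) → ∀ xs → count P? xs * w ≤ sum (map g xs)
  markov P? g w below [] = z≤n
  markov P? g w below (x ∷ xs) with P? x
  ... | yes px = +-mono-≤ (below x px) (markov P? g w below xs)
  ... | no  _  = ≤-trans (markov P? g w below xs) (m≤n+m _ (g x))

sum-map-scale : ∀ {a} {A : Set a} (g h : A → ℕ) c → (∀ x → g x ≡ c * h x) →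
                ∀ xs → sum (map g xs) ≡ c * sum (map h xs)
sum-map-scale g h c g≡ch []       = sym (*-zeroʳ c)
sum-map-scale g h c g≡ch (x ∷ xs) =
  trans (cong₂ _+_ (g≡ch x) (sum-map-scale g h c g≡ch xs)) (sym (*-distribˡ-+ c (h x) _))

weight : ∀ {n} → Subset n → ℕ → ℕ → Subset n → ℕ
weight S a b R = a ^ ∣ S ∩ R ∣ * b ^ ∣ S ∩ ∁ R ∣

module _ where
  open import Data.Vec using ([]; _∷_)

  sum-allSubsets : ∀ n (g : Subset (suc n) → ℕ) →
    sum (map g (allSubsets (suc n)))
      ≡ sum (map (λ R → g (false ∷ R)) (allSubsets n)) + sum (map (λ R → g (true ∷ R)) (allSubsets n))
  sum-allSubsets n g = begin
    sum (map g (F ++ T))         ≡⟨ cong sum (map-++ g F T) ⟩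
    sum (map g F ++ map g T)     ≡⟨ sum-++ (map g F) (map g T) ⟩
    sum (map g F) + sum (map g T) ≡⟨ cong₂ _+_ (cong sum (map-∘ (allSubsets n))) (cong sum (map-∘ (allSubsets n))) ⟨
    sum (map (λ R → g (false ∷ R)) (allSubsets n)) + sum (map (λ R → g (true ∷ R)) (allSubsets n)) ∎
    where
    open ≡-Reasoning
    F = map (false ∷_) (allSubsets n)
    T = map (true ∷_) (allSubsets n)

  weight-sum : ∀ n (S : Subset n) a b →
    sum (map (weight S a b) (allSubsets n)) ≡ (a + b) ^ ∣ S ∣ * 2 ^ (n ∸ ∣ S ∣)
  weight-sum zero [] a b = refl
  weight-sum (suc n) (true ∷ S) a b = begin
    sum (map (weight (true ∷ S) a b) (allSubsets (suc n)))
      ≡⟨ sum-allSubsets n (weight (true ∷ S) a b) ⟩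
    sum (map (λ R → weight (true ∷ S) a b (false ∷ R)) (allSubsets n))
      + sum (map (λ R → weight (true ∷ S) a b (true ∷ R)) (allSubsets n))
      ≡⟨ cong₂ _+_
           (sum-map-scale _ (weight S a b) b (λ R → x∙yz≈y∙xz (a ^ ∣ S ∩ R ∣) b _) (allSubsets n))
           (sum-map-scale _ (weight S a b) a (λ R → *-assoc a _ _) (allSubsets n)) ⟩
    b * Σw + a * Σw      ≡⟨ cong (λ t → b * t + a * t) (weight-sum n S a b) ⟩
    b * (X * Y) + a * (X * Y) ≡⟨ *-distribʳ-+ (X * Y) b a ⟨
    (b + a) * (X * Y)    ≡⟨ cong (_* (X * Y)) (+-comm b a) ⟩
    (a + b) * (X * Y)    ≡⟨ *-assoc (a + b) X Y ⟨
    (a + b) * X * Y      ∎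
    where
    open ≡-Reasoning
    Σw = sum (map (weight S a b) (allSubsets n))
    X = (a + b) ^ ∣ S ∣
    Y = 2 ^ (n ∸ ∣ S ∣)
  weight-sum (suc n) (false ∷ S) a b = begin
    sum (map (weight (false ∷ S) a b) (allSubsets (suc n)))
      ≡⟨ sum-allSubsets n (weight (false ∷ S) a b) ⟩
    Σw + Σw              ≡⟨ cong (λ t → t + t) (weight-sum n S a b) ⟩
    X * Y + X * Y        ≡⟨ *-distribˡ-+ X Y Y ⟨
    X * (Y + Y)          ≡⟨ cong (λ t → X * (Y + t)) (+-identityʳ Y) ⟨
    X * 2 ^ suc (n ∸ ∣ S ∣) ≡⟨ cong (λ e → X * 2 ^ e) (+-∸-assoc 1 (∣p∣≤n S)) ⟨
    X * 2 ^ (suc n ∸ ∣ S ∣) ∎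
    where
    open ≡-Reasoning
    Σw = sum (map (weight S a b) (allSubsets n))
    X = (a + b) ^ ∣ S ∣
    Y = 2 ^ (n ∸ ∣ S ∣)

^-distribʳ-* : ∀ a b m → (a * b) ^ m ≡ a ^ m * b ^ m
^-distribʳ-* a b zero    = refl
^-distribʳ-* a b (suc m) = trans (cong ((a * b) *_) (^-distribʳ-* a b m)) (interchange a b (a ^ m) (b ^ m))

weighted-count : ∀ {n} (S : Subset n) {p} {P : Pred (Subset n) p} (P? : Decidable P) a b Q w K →
  .{{_ : NonZero Q}} → a + b ≡ 2 * Q → Q ^ ∣ S ∣ * K ≤ w →
  (∀ R → P R → w ≤ weight S a b R) → count P? (allSubsets n) * K ≤ 2 ^ n
weighted-count {n} S P? a b Q w K a+b≡2Q QK≤w heavy =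
  *-cancelʳ-≤ (c * K) (2 ^ n) (Q ^ s) {{m^n≢0 Q s}} (begin
    c * K * Q ^ s                  ≡⟨ *-assoc c K (Q ^ s) ⟩
    c * (K * Q ^ s)                ≡⟨ cong (c *_) (*-comm K (Q ^ s)) ⟩
    c * (Q ^ s * K)                ≤⟨ *-monoʳ-≤ c QK≤w ⟩
    c * w                          ≤⟨ markov P? (weight S a b) w heavy (allSubsets n) ⟩
    sum (map (weight S a b) (allSubsets n)) ≡⟨ weight-sum n S a b ⟩
    (a + b) ^ s * 2 ^ (n ∸ s)      ≡⟨ cong (λ t → t ^ s * 2 ^ (n ∸ s)) (trans a+b≡2Q (*-comm 2 Q)) ⟩
    (Q * 2) ^ s * 2 ^ (n ∸ s)      ≡⟨ cong (_* 2 ^ (n ∸ s)) (^-distribʳ-* Q 2 s) ⟩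
    Q ^ s * 2 ^ s * 2 ^ (n ∸ s)    ≡⟨ *-assoc (Q ^ s) (2 ^ s) (2 ^ (n ∸ s)) ⟩
    Q ^ s * (2 ^ s * 2 ^ (n ∸ s))  ≡⟨ cong (Q ^ s *_) (^-distribˡ-+-* 2 s (n ∸ s)) ⟨
    Q ^ s * 2 ^ (s + (n ∸ s))      ≡⟨ cong (λ e → Q ^ s * 2 ^ e) (m+[n∸m]≡n (∣p∣≤n S)) ⟩
    Q ^ s * 2 ^ n                  ≡⟨ *-comm (Q ^ s) (2 ^ n) ⟩
    2 ^ n * Q ^ s                  ∎)
  where
  open ≤-Reasoning
  s = ∣ S ∣
  c = count P? (allSubsets n)

-- Upper Bernoulli-type bound: (1 + 1/x)^m ≤ (x + 1)/(x + 1 - m) for m ≤ x,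
-- written as (x + 1)^m (y + 1) ≤ x^m (x + 1) where x = m + y.
bernoulli-upper : ∀ x m y → x ≡ m + y → suc x ^ m * suc y ≤ x ^ m * suc x
bernoulli-upper x zero    y refl = ≤-refl
bernoulli-upper x (suc m) y x≡ = begin
  suc x * suc x ^ m * suc y     ≡⟨ xy∙z≈y∙xz (suc x) (suc x ^ m) (suc y) ⟩
  suc x ^ m * (suc x * suc y)   ≤⟨ *-monoʳ-≤ (suc x ^ m) step ⟩
  suc x ^ m * (x * suc (suc y)) ≡⟨ x∙yz≈y∙xz (suc x ^ m) x (suc (suc y)) ⟩
  x * (suc x ^ m * suc (suc y)) ≤⟨ *-monoʳ-≤ x (bernoulli-upper x m (suc y) (trans x≡ (sym (+-suc m y)))) ⟩
  x * (x ^ m * suc x)           ≡⟨ *-assoc x (x ^ m) (suc x) ⟨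
  x * x ^ m * suc x             ∎
  where
  open ≤-Reasoning
  step : suc x * suc y ≤ x * suc (suc y)
  step rewrite x≡ = begin
    suc (suc m + y) * suc y     ≤⟨ m≤m+n _ m ⟩
    suc (suc m + y) * suc y + m ≡⟨ solve (m ∷ y ∷ []) ⟩
    (suc m + y) * suc (suc y)   ∎

half-≤ : ∀ m x → 2 * m ≤ suc x → m ≤ x
half-≤ zero    x _  = z≤n
half-≤ (suc m) x le = ≤-trans (m≤n+m (suc m) m)
  (≤-pred (subst (_≤ suc x) (cong (suc m +_) (+-identityʳ (suc m))) le))

growth-half : ∀ x m → 2 * m ≤ suc x → suc x ^ m ≤ 2 * x ^ m
growth-half x m 2m≤1+x = *-cancelʳ-≤ (suc x ^ m) (2 * x ^ m) (suc x) (begin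
  suc x ^ m * suc x         ≤⟨ *-monoʳ-≤ (suc x ^ m) 1+x≤2[1+y] ⟩
  suc x ^ m * (2 * suc y)   ≡⟨ x∙yz≈y∙xz (suc x ^ m) 2 (suc y) ⟩
  2 * (suc x ^ m * suc y)   ≤⟨ *-monoʳ-≤ 2 (bernoulli-upper x m y x≡m+y) ⟩
  2 * (x ^ m * suc x)       ≡⟨ *-assoc 2 (x ^ m) (suc x) ⟨
  2 * x ^ m * suc x         ∎)
  where
  open ≤-Reasoning
  y = x ∸ m
  x≡m+y : x ≡ m + y
  x≡m+y = sym (m+[n∸m]≡n (half-≤ m x 2m≤1+x))
  1+x≡m+[1+y] : suc x ≡ m + suc y
  1+x≡m+[1+y] = trans (cong suc x≡m+y) (sym (+-suc m y))
  m≤1+y : m ≤ suc y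
  m≤1+y = +-cancelˡ-≤ m m (suc y) (begin
    m + m        ≡⟨ cong (m +_) (+-identityʳ m) ⟨
    2 * m        ≤⟨ 2m≤1+x ⟩
    suc x        ≡⟨ 1+x≡m+[1+y] ⟩
    m + suc y    ∎)
  1+x≤2[1+y] : suc x ≤ 2 * suc y
  1+x≤2[1+y] = begin
    suc x          ≡⟨ 1+x≡m+[1+y] ⟩
    m + suc y      ≤⟨ +-monoˡ-≤ (suc y) m≤1+y ⟩
    suc y + suc y  ≡⟨ cong (suc y +_) (+-identityʳ (suc y)) ⟨
    2 * suc y      ∎

-- Iterating: (1 + 1/x)^m ≤ 2^t as long as m ≤ t·h with 2h ≤ x + 1.
-- Split off a block of at most h factors at each step.
growth : ∀ x h t m → 2 * h ≤ suc x → m ≤ t * h → suc x ^ m ≤ 2 ^ t * x ^ m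
growth x h zero    zero    _  _  = ≤-refl
growth x h zero    (suc m) _  ()
growth x h (suc t) m       2h≤1+x m≤h+th = begin
  suc x ^ m                             ≡⟨ cong (suc x ^_) (m⊓n+n∸m≡n h m) ⟨
  suc x ^ (m₁ + m₂)                     ≡⟨ ^-distribˡ-+-* (suc x) m₁ m₂ ⟩
  suc x ^ m₁ * suc x ^ m₂               ≤⟨ *-mono-≤ (growth-half x m₁ 2m₁≤1+x) (growth x h t m₂ 2h≤1+x m₂≤th) ⟩
  2 * x ^ m₁ * (2 ^ t * x ^ m₂)         ≡⟨ interchange 2 (x ^ m₁) (2 ^ t) (x ^ m₂) ⟩
  2 ^ suc t * (x ^ m₁ * x ^ m₂)         ≡⟨ cong (2 ^ suc t *_) (^-distribˡ-+-* x m₁ m₂) ⟨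
  2 ^ suc t * x ^ (m₁ + m₂)             ≡⟨ cong (λ e → 2 ^ suc t * x ^ e) (m⊓n+n∸m≡n h m) ⟩
  2 ^ suc t * x ^ m                     ∎
  where
  open ≤-Reasoning
  m₁ = h ℕ.⊓ m
  m₂ = m ∸ h
  2m₁≤1+x : 2 * m₁ ≤ suc x
  2m₁≤1+x = ≤-trans (*-monoʳ-≤ 2 (m⊓n≤m h m)) 2h≤1+x
  m₂≤th : m₂ ≤ t * h
  m₂≤th = subst (m₂ ≤_) (m+n∸m≡n h (t * h)) (∸-monoˡ-≤ h m≤h+th)

-- Lower Bernoulli bound: (1 + 1/q)^m ≥ 1 + m/q.
bernoulli-lower : ∀ q m → q ^ m * (q + m) ≤ suc q ^ m * q
bernoulli-lower q zero    = ≤-reflexive (cong (1 *_) (+-identityʳ q))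
bernoulli-lower q (suc m) = begin
  q * q ^ m * (q + suc m)   ≡⟨ xy∙z≈y∙xz q (q ^ m) (q + suc m) ⟩
  q ^ m * (q * (q + suc m)) ≤⟨ *-monoʳ-≤ (q ^ m) step ⟩
  q ^ m * (suc q * (q + m)) ≡⟨ x∙yz≈y∙xz (q ^ m) (suc q) (q + m) ⟩
  suc q * (q ^ m * (q + m)) ≤⟨ *-monoʳ-≤ (suc q) (bernoulli-lower q m) ⟩
  suc q * (suc q ^ m * q)   ≡⟨ *-assoc (suc q) (suc q ^ m) q ⟨
  suc q * suc q ^ m * q     ∎
  where
  open ≤-Reasoning
  step : q * (q + suc m) ≤ suc q * (q + m)
  step = begin
    q * (q + suc m)       ≤⟨ m≤m+n _ m ⟩
    q * (q + suc m) + m   ≡⟨ solve (q ∷ m ∷ []) ⟩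
    suc q * (q + m)       ∎

doubling : ∀ q → 2 * suc q ^ suc q ≤ suc (suc q) ^ suc q
doubling q = *-cancelʳ-≤ (2 * Q ^ Q) (suc Q ^ Q) Q (begin
  2 * Q ^ Q * Q       ≡⟨ xy∙z≈y∙xz 2 (Q ^ Q) Q ⟩
  Q ^ Q * (2 * Q)     ≡⟨ cong (λ t → Q ^ Q * (Q + t)) (+-identityʳ Q) ⟩
  Q ^ Q * (Q + Q)     ≤⟨ bernoulli-lower Q Q ⟩
  suc Q ^ Q * Q       ∎)
  where
  open ≤-Reasoning
  Q = suc q

doubling-iterate : ∀ q t u → t * suc q ≤ u → 2 ^ t * suc q ^ u ≤ suc (suc q) ^ u
doubling-iterate q zero    u _ = ≤-trans (≤-reflexive (*-identityˡ _)) (^-monoˡ-≤ u (n≤1+n (suc q)))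
doubling-iterate q (suc t) u Q+tQ≤u = begin
  2 * 2 ^ t * Q ^ u                          ≡⟨ cong (2 * 2 ^ t *_) (split Q) ⟩
  2 * 2 ^ t * (Q ^ Q * Q ^ (u ∸ Q))          ≡⟨ interchange 2 (2 ^ t) (Q ^ Q) (Q ^ (u ∸ Q)) ⟩
  2 * Q ^ Q * (2 ^ t * Q ^ (u ∸ Q))          ≤⟨ *-mono-≤ (doubling q) (doubling-iterate q t (u ∸ Q) tQ≤u∸Q) ⟩
  suc Q ^ Q * suc Q ^ (u ∸ Q)                ≡⟨ split (suc Q) ⟨
  suc Q ^ u                                  ∎
  where
  open ≤-Reasoning
  Q = suc q
  Q≤u : Q ≤ u
  Q≤u = ≤-trans (m≤m+n Q (t * Q)) Q+tQ≤u
  split : ∀ b → b ^ u ≡ b ^ Q * b ^ (u ∸ Q)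
  split b = trans (cong (b ^_) (sym (m+[n∸m]≡n Q≤u))) (^-distribˡ-+-* b Q (u ∸ Q))
  tQ≤u∸Q : t * Q ≤ u ∸ Q
  tQ≤u∸Q = subst (_≤ u ∸ Q) (m+n∸m≡n Q (t * Q)) (∸-monoˡ-≤ Q Q+tQ≤u)

deviation-weight : ∀ a b m u k j → b ≤ a → j ≤ m → k + j ≡ 2 * m + u →
                   (a * b) ^ m * a ^ u ≤ a ^ k * b ^ j
deviation-weight a b m u k j b≤a j≤m k+j≡2m+u = begin
  (a * b) ^ m * a ^ u                   ≡⟨ cong (_* a ^ u) (^-distribʳ-* a b m) ⟩
  a ^ m * b ^ m * a ^ u                 ≡⟨ cong (λ e → a ^ m * b ^ e * a ^ u) j+d≡m ⟨
  a ^ m * b ^ (j + d) * a ^ u           ≡⟨ cong (λ t → a ^ m * t * a ^ u) (^-distribˡ-+-* b j d) ⟩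
  a ^ m * (b ^ j * b ^ d) * a ^ u       ≤⟨ *-monoˡ-≤ (a ^ u) (*-monoʳ-≤ (a ^ m) (*-monoʳ-≤ (b ^ j) (^-monoˡ-≤ d b≤a))) ⟩
  a ^ m * (b ^ j * a ^ d) * a ^ u       ≡⟨ regroup (a ^ m) (b ^ j) (a ^ d) (a ^ u) ⟩
  a ^ m * a ^ d * a ^ u * b ^ j         ≡⟨ cong (λ t → t * a ^ u * b ^ j) (^-distribˡ-+-* a m d) ⟨
  a ^ (m + d) * a ^ u * b ^ j           ≡⟨ cong (_* b ^ j) (^-distribˡ-+-* a (m + d) u) ⟨
  a ^ (m + d + u) * b ^ j               ≡⟨ cong (λ e → a ^ e * b ^ j) m+d+u≡k ⟩
  a ^ k * b ^ j                         ∎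
  where
  open ≤-Reasoning
  d = m ∸ j
  j+d≡m : j + d ≡ m
  j+d≡m = m+[n∸m]≡n j≤m
  regroup : ∀ x y z w → x * (y * z) * w ≡ x * z * w * y
  regroup = solve-∀
  shuffle : ∀ m d u j → m + d + u + j ≡ m + (j + d) + u
  shuffle = solve-∀
  m+d+u≡k : m + d + u ≡ k
  m+d+u≡k = +-cancelʳ-≡ j _ _ (begin-equality
    m + d + u + j         ≡⟨ shuffle m d u j ⟩
    m + (j + d) + u       ≡⟨ cong (λ t → m + t + u) j+d≡m ⟩
    m + m + u             ≡⟨ cong (λ t → m + t + u) (+-identityʳ m) ⟨
    2 * m + u             ≡⟨ k+j≡2m+u ⟨
    k + j                 ∎)

-- With a = Q + 1 and
-- b = Q - 1 (so ab + 1 = Q²): if m ≤ W·h for 2h ≤ Q², 2W·Q ≤ u and K ≤ 2^W,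
-- then Q^(2m+u) K ≤ (ab)^m a^u.  The factor (Q²/(Q²-1))^m costs at most 2^W
-- and is paid for, together with K, by (1 + 1/Q)^u ≥ 2^(2W).
moment-bound : ∀ q h W m u K → 2 * h ≤ suc q * suc q → m ≤ W * h → 2 * W * suc q ≤ u →
  K ≤ 2 ^ W → suc q ^ (2 * m + u) * K ≤ ((2 + q) * q) ^ m * (2 + q) ^ u
moment-bound q h W m u K 2h≤Q² m≤Wh 2WQ≤u K≤2^W = begin
  Q ^ (2 * m + u) * K                  ≡⟨ cong (_* K) Q-power ⟩
  suc x ^ m * Q ^ u * K                ≤⟨ *-mono-≤ (*-monoˡ-≤ (Q ^ u) (growth x h W m 2h≤1+x m≤Wh)) K≤2^W ⟩
  2 ^ W * x ^ m * Q ^ u * 2 ^ W        ≡⟨ regroup (2 ^ W) (x ^ m) (Q ^ u) ⟩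
  x ^ m * (2 ^ W * 2 ^ W * Q ^ u)      ≡⟨ cong (λ t → x ^ m * (t * Q ^ u)) 2^W*2^W ⟩
  x ^ m * (2 ^ (2 * W) * Q ^ u)        ≤⟨ *-monoʳ-≤ (x ^ m) (doubling-iterate q (2 * W) u 2WQ≤u) ⟩
  x ^ m * (2 + q) ^ u                  ∎
  where
  open ≤-Reasoning
  Q = suc q
  x = (2 + q) * q
  1+x≡Q² : suc x ≡ Q * Q
  1+x≡Q² = square q
    where
    square : ∀ q → suc ((2 + q) * q) ≡ suc q * suc q
    square = solve-∀
  2h≤1+x : 2 * h ≤ suc x
  2h≤1+x = subst (2 * h ≤_) (sym 1+x≡Q²) 2h≤Q²
  Q-power : Q ^ (2 * m + u) ≡ suc x ^ m * Q ^ u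
  Q-power = begin-equality
    Q ^ (2 * m + u)          ≡⟨ ^-distribˡ-+-* Q (2 * m) u ⟩
    Q ^ (m + (m + 0)) * Q ^ u ≡⟨ cong (λ e → Q ^ (m + e) * Q ^ u) (+-identityʳ m) ⟩
    Q ^ (m + m) * Q ^ u      ≡⟨ cong (_* Q ^ u) (^-distribˡ-+-* Q m m) ⟩
    Q ^ m * Q ^ m * Q ^ u    ≡⟨ cong (_* Q ^ u) (^-distribʳ-* Q Q m) ⟨
    (Q * Q) ^ m * Q ^ u      ≡⟨ cong (λ t → t ^ m * Q ^ u) 1+x≡Q² ⟨
    suc x ^ m * Q ^ u        ∎
  2^W*2^W : 2 ^ W * 2 ^ W ≡ 2 ^ (2 * W)
  2^W*2^W = trans (sym (^-distribˡ-+-* 2 W W)) (cong (λ e → 2 ^ (W + e)) (sym (+-identityʳ W)))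
  regroup : ∀ t y z → t * y * z * t ≡ y * (t * t * z)
  regroup = solve-∀

light-side : ∀ s D k j → k + j ≡ s → 2 * s + D < 4 * k → j ≤ (2 * s ∸ D) / 4
light-side _ D k j refl bad =
  subst (_≤ (2 * (k + j) ∸ D) / 4) (m*n/n≡m j 4) (/-monoˡ-≤ 4 (subst (_≤ 2 * (k + j) ∸ D) (*-comm 4 j)
    (m+n≤o⇒m≤o∸n (4 * j) (<⇒≤ (+-cancelˡ-< (2 * (k + j)) (4 * j + D) (2 * (k + j)) (begin-strict
      2 * (k + j) + (4 * j + D) ≡⟨ solve (k ∷ j ∷ D ∷ []) ⟩
      2 * (k + j) + D + 4 * j   <⟨ +-monoˡ-< (4 * j) bad ⟩
      4 * k + 4 * j             ≡⟨ solve (k ∷ j ∷ []) ⟩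
      2 * (k + j) + 2 * (k + j) ∎))))))
  where open ≤-Reasoning

deficit-bounds : ∀ s D m → m * 4 ≤ 2 * s ∸ D → D ≤ 2 * s → 2 * m ≤ s × D ≤ 2 * (s ∸ 2 * m)
deficit-bounds s D m 4m≤2s∸D D≤2s = 2m≤s , +-cancelˡ-≤ (m * 4) D _ (begin
  m * 4 + D                 ≤⟨ +-monoˡ-≤ D 4m≤2s∸D ⟩
  2 * s ∸ D + D             ≡⟨ m∸n+n≡m D≤2s ⟩
  2 * s                     ≡⟨ cong (2 *_) (m+[n∸m]≡n 2m≤s) ⟨
  2 * (2 * m + (s ∸ 2 * m)) ≡⟨ double (s ∸ 2 * m) ⟩
  m * 4 + 2 * (s ∸ 2 * m)   ∎)
  where
  open ≤-Reasoning
  2m≤s : 2 * m ≤ s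
  2m≤s = *-cancelˡ-≤ 2 (begin
    2 * (2 * m)  ≡⟨ solve (m ∷ []) ⟩
    m * 4        ≤⟨ 4m≤2s∸D ⟩
    2 * s ∸ D    ≤⟨ m∸n≤m (2 * s) D ⟩
    2 * s        ∎)
  double : ∀ u → 2 * (2 * m + u) ≡ m * 4 + 2 * u
  double u = solve (m ∷ u ∷ [])

div-upper : ∀ D M .{{_ : NonZero M}} → D < suc (D / M) * M
div-upper D M = begin-strict
  D                   ≡⟨ m≡m%n+[m/n]*n D M ⟩
  D % M + D / M * M   <⟨ +-monoˡ-< (D / M * M) (m%n<n D M) ⟩
  M + D / M * M       ∎
  where open ≤-Reasoning

-- Consequences of 144 W s ≤ D² for the step p = ⌊D/8W⌋ of the moment
-- method: D ≥ 16W when D < 2s, and s < W p².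
ratio-large : ∀ s D W → 144 * W * s ≤ D * D → D < 2 * s → 16 * W ≤ D
ratio-large s D W 144Ws≤D² D<2s = ≮⇒≥ λ D<16W → <⇒≱ (*-mono-< D<16W D<2s) (begin
  16 * W * (2 * s)                 ≤⟨ m≤m+n _ (112 * W * s) ⟩
  16 * W * (2 * s) + 112 * W * s   ≡⟨ solve (W ∷ s ∷ []) ⟩
  144 * W * s                      ≤⟨ 144Ws≤D² ⟩
  D * D                            ∎)
  where open ≤-Reasoning

ratio-square : ∀ s D W p → 144 * W * s ≤ D * D → D < suc p * (8 * W) → 2 ≤ p → s < W * (p * p)
ratio-square s D W p 144Ws≤D² D<[1+p]8W 2≤p = *-cancelˡ-< 9 s (W * (p * p)) (begin-strict
  9 * s                                  <⟨ *-cancelˡ-< (16 * W) (9 * s) _ (begin-strict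
      16 * W * (9 * s)                   ≡⟨ solve (W ∷ s ∷ []) ⟩
      144 * W * s                        ≤⟨ 144Ws≤D² ⟩
      D * D                              <⟨ *-mono-< D<[1+p]8W D<[1+p]8W ⟩
      suc p * (8 * W) * (suc p * (8 * W)) ≡⟨ solve (p ∷ W ∷ []) ⟩
      16 * W * (W * (2 * suc p * (2 * suc p))) ∎) ⟩
  W * (2 * suc p * (2 * suc p))          ≤⟨ *-monoʳ-≤ W (*-mono-≤ 2[1+p]≤3p 2[1+p]≤3p) ⟩
  W * (3 * p * (3 * p))                  ≡⟨ solve (W ∷ p ∷ []) ⟩
  9 * (W * (p * p))                      ∎)
  where
  open ≤-Reasoning
  2[1+p]≤3p : 2 * suc p ≤ 3 * p
  2[1+p]≤3p = begin
    2 * suc p     ≡⟨ solve (p ∷ []) ⟩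
    2 * p + 2     ≤⟨ +-monoʳ-≤ (2 * p) 2≤p ⟩
    2 * p + p     ≡⟨ solve (p ∷ []) ⟩
    3 * p         ∎

HeavyDeviations : (s D a b w : ℕ) → Set
HeavyDeviations s D a b w = ∀ k j → k + j ≡ s → 2 * s + D < 4 * k → w ≤ a ^ k * b ^ j

no-large-deviation : ∀ s D a b w → 2 * s ≤ D → HeavyDeviations s D a b w
no-large-deviation s D a b w 2s≤D k j k+j≡s 2s+D<4k = ⊥-elim (<⇒≱ 2s+D<4k (begin
  4 * k          ≤⟨ *-monoʳ-≤ 4 (subst (k ≤_) k+j≡s (m≤m+n k j)) ⟩
  4 * s          ≡⟨ solve (s ∷ []) ⟩
  2 * s + 2 * s  ≤⟨ +-monoʳ-≤ (2 * s) 2s≤D ⟩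
  2 * s + D      ∎))
  where open ≤-Reasoning

-- We split s = 2m + u with m = ⌊(2s - D)/4⌋, the largest possible light side.
moment-weights : ∀ s D E K → K ≤ 2 ^ E → 144 * suc E * s ≤ D * D → D < 2 * s →
  Σ ℕ λ q → Σ ℕ λ w → HeavyDeviations s D (2 + q) q w × suc q ^ s * K ≤ w
moment-weights s D E K K≤2^E 144Ws≤D² D<2s = q , w , heavy , moment
  where
  open ≤-Reasoning
  W = suc E
  p = D / (8 * W)
  q = 2 * p ∸ 1
  m = (2 * s ∸ D) / 4
  u = s ∸ 2 * m
  w = ((2 + q) * q) ^ m * (2 + q) ^ u
  2≤p : 2 ≤ p
  2≤p = subst (_≤ p) (m*n/n≡m 2 (8 * W)) (/-monoˡ-≤ (8 * W)
    (subst (_≤ D) (*-assoc 2 8 W) (ratio-large s D W 144Ws≤D² D<2s)))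
  Q≡2p : suc q ≡ 2 * p
  Q≡2p = m+[n∸m]≡n (≤-trans (s≤s z≤n) (≤-trans 2≤p (m≤m+n p (p + 0))))
  deficit : 2 * m ≤ s × D ≤ 2 * u
  deficit = deficit-bounds s D m (m/n*n≤m (2 * s ∸ D) 4) (<⇒≤ D<2s)
  s≡2m+u : 2 * m + u ≡ s
  s≡2m+u = m+[n∸m]≡n (proj₁ deficit)
  heavy : HeavyDeviations s D (2 + q) q w
  heavy k j k+j≡s bad = deviation-weight (2 + q) q m u k j (m≤n+m q 2)
    (light-side s D k j k+j≡s bad) (trans k+j≡s (sym s≡2m+u))
  2pQ≤Q² : 2 * (p * suc q) ≤ suc q * suc q
  2pQ≤Q² = ≤-reflexive (trans (sym (*-assoc 2 p (suc q))) (cong (_* suc q) (sym Q≡2p)))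
  m≤WpQ : m ≤ W * (p * suc q)
  m≤WpQ = begin
    m               ≤⟨ ≤-trans (m≤m+n m (m + 0)) (proj₁ deficit) ⟩
    s               ≤⟨ <⇒≤ (ratio-square s D W p 144Ws≤D² (div-upper D (8 * W)) 2≤p) ⟩
    W * (p * p)     ≤⟨ *-monoʳ-≤ W (*-monoʳ-≤ p (subst (p ≤_) (sym Q≡2p) (m≤m+n p (p + 0)))) ⟩
    W * (p * suc q) ∎
  2WQ≤u : 2 * W * suc q ≤ u
  2WQ≤u = *-cancelˡ-≤ 2 (begin
    2 * (2 * W * suc q)   ≡⟨ cong (λ t → 2 * (2 * W * t)) Q≡2p ⟩
    2 * (2 * W * (2 * p)) ≡⟨ eight W p ⟩
    p * (8 * W)           ≤⟨ m/n*n≤m D (8 * W) ⟩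
    D                     ≤⟨ proj₂ deficit ⟩
    2 * u                 ∎)
    where
    eight : ∀ W p → 2 * (2 * W * (2 * p)) ≡ p * (8 * W)
    eight = solve-∀
  moment : suc q ^ s * K ≤ w
  moment = subst (λ e → suc q ^ e * K ≤ w) s≡2m+u (moment-bound q (p * suc q) W m u K 2pQ≤Q² m≤WpQ 2WQ≤u
    (≤-trans K≤2^E (^-monoʳ-≤ 2 (n≤1+n E))))

deviation-weights : ∀ s D E K → K ≤ 2 ^ E → 144 * suc E * s ≤ D * D →
  Σ ℕ λ q → Σ ℕ λ w → HeavyDeviations s D (2 + q) q w × suc q ^ s * K ≤ w
deviation-weights s D E K K≤2^E 144Ws≤D² with 2 * s ≤? D
... | yes 2s≤D = 0 , K , no-large-deviation s D 2 0 K 2s≤D ,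
                 ≤-reflexive (trans (cong (_* K) (^-zeroˡ s)) (*-identityˡ K))
... | no 2s≰D  = moment-weights s D E K K≤2^E 144Ws≤D² (≰⇒> 2s≰D)

overfull? : ∀ {n} (S : Subset n) (D : ℕ) → Decidable (λ R → 2 * ∣ S ∣ + D < 4 * ∣ S ∩ R ∣)
overfull? S D R = 2 * ∣ S ∣ + D <? 4 * ∣ S ∩ R ∣

underfull? : ∀ {n} (S : Subset n) (D : ℕ) → Decidable (λ R → 2 * ∣ S ∣ + D < 4 * ∣ S ∩ ∁ R ∣)
underfull? S D R = 2 * ∣ S ∣ + D <? 4 * ∣ S ∩ ∁ R ∣

deviation-counts : ∀ {n} (S : Subset n) D E K → K ≤ 2 ^ E → 144 * suc E * ∣ S ∣ ≤ D * D →
  count (overfull? S D) (allSubsets n) * K ≤ 2 ^ n × count (underfull? S D) (allSubsets n) * K ≤ 2 ^ n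
deviation-counts S D E K K≤2^E 144Ws≤D² with deviation-weights ∣ S ∣ D E K K≤2^E 144Ws≤D²
... | q , w , heavy , QK≤w =
  weighted-count S (overfull? S D) (2 + q) q (suc q) w K (mean q) QK≤w
    (λ R dev → heavy ∣ S ∩ R ∣ ∣ S ∩ ∁ R ∣ (split-card S R) dev) ,
  weighted-count S (underfull? S D) q (2 + q) (suc q) w K (trans (+-comm q (2 + q)) (mean q)) QK≤w
    (λ R dev → subst (w ≤_) (*-comm ((2 + q) ^ ∣ S ∩ ∁ R ∣) (q ^ ∣ S ∩ R ∣))
                 (heavy ∣ S ∩ ∁ R ∣ ∣ S ∩ R ∣ (split-card′ S R) dev))
  where
  mean : ∀ q → 2 + q + q ≡ 2 * suc q
  mean = solve-∀

binomial-factorials : ∀ n k → k ≤ n → (n C k) * (k ! * (n ∸ k) !) ≡ n !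
binomial-factorials n k k≤n = trans (cong (_* (k ! * (n ∸ k) !)) (nCk≡n!/k![n-k]! k≤n))
  (m/n*n≡m {{k !* (n ∸ k) !≢0}} (k![n∸k]!∣n! k≤n))

central : ℕ → ℕ
central m = (m * 2) C m

central-factorials : ∀ m → central m * (m ! * m !) ≡ (m * 2) !
central-factorials m = subst (λ t → central m * (m ! * t !) ≡ (m * 2) !) m*2∸m≡m
  (binomial-factorials (m * 2) m (m≤m*n m 2))
  where
  m*2∸m≡m : m * 2 ∸ m ≡ m
  m*2∸m≡m = trans (cong (_∸ m) (*-comm m 2)) (trans (cong (λ t → m + t ∸ m) (+-identityʳ m)) (m+n∸m≡n m m))

central-step : ∀ m → central (suc m) * suc m ≡ 2 * (1 + m * 2) * central m
central-step m = *-cancelʳ-≡ _ _ (suc m) (*-cancelʳ-≡ _ _ (m ! * m !) {{m !* m !≢0}} (begin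
  central (suc m) * suc m * suc m * (m ! * m !)
    ≡⟨ regroup (central (suc m)) (suc m) (m !) ⟩
  central (suc m) * (suc m ! * suc m !)
    ≡⟨ central-factorials (suc m) ⟩
  (2 + m * 2) * ((1 + m * 2) * (m * 2) !)
    ≡⟨ cong (λ t → (2 + m * 2) * ((1 + m * 2) * t)) (central-factorials m) ⟨
  (2 + m * 2) * ((1 + m * 2) * (central m * (m ! * m !)))
    ≡⟨ unfold m (central m) (m ! * m !) ⟩
  2 * (1 + m * 2) * central m * suc m * (m ! * m !) ∎))
  where
  open ≡-Reasoning
  regroup : ∀ c s f → c * s * s * (f * f) ≡ c * ((s * f) * (s * f))
  regroup = solve-∀
  unfold : ∀ m c F → (2 + m * 2) * ((1 + m * 2) * (c * F)) ≡ 2 * (1 + m * 2) * c * suc m * F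
  unfold = solve-∀

central-bound : ∀ m → 2 ^ (m * 2) ≤ suc (m * 2) * central m
central-bound zero    = s≤s z≤n
central-bound (suc m) = *-cancelʳ-≤ _ _ (suc m) (begin
  2 * (2 * 2 ^ (m * 2)) * suc m              ≡⟨ regroup (2 ^ (m * 2)) m ⟩
  4 * suc m * 2 ^ (m * 2)                    ≤⟨ *-monoʳ-≤ (4 * suc m) (central-bound m) ⟩
  4 * suc m * (suc (m * 2) * central m)      ≤⟨ *-monoˡ-≤ (suc (m * 2) * central m) (m≤m+n (4 * suc m) 2) ⟩
  (4 * suc m + 2) * (suc (m * 2) * central m) ≡⟨ regroup′ m (central m) ⟩
  (3 + m * 2) * (2 * (1 + m * 2) * central m) ≡⟨ cong ((3 + m * 2) *_) (central-step m) ⟨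
  (3 + m * 2) * (central (suc m) * suc m)    ≡⟨ *-assoc (3 + m * 2) (central (suc m)) (suc m) ⟨
  (3 + m * 2) * central (suc m) * suc m      ∎)
  where
  open ≤-Reasoning
  regroup : ∀ P m → 2 * (2 * P) * suc m ≡ 4 * suc m * P
  regroup = solve-∀
  regroup′ : ∀ m c → (4 * suc m + 2) * (suc (m * 2) * c) ≡ (3 + m * 2) * (2 * (1 + m * 2) * c)
  regroup′ = solve-∀

central-binomial : ∀ n → 2 ∣ n → 2 ^ n ≤ suc n * (n C (n / 2))
central-binomial .(m * 2) (divides m refl) =
  subst (λ k → 2 ^ (m * 2) ≤ suc (m * 2) * ((m * 2) C k)) (sym (m*n/n≡m m 2)) (central-bound m)

two-tails : ∀ n b c₁ c₂ X C → b ≤ c₁ + c₂ → c₁ * (suc n * (2 * X)) ≤ 2 ^ n →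
            c₂ * (suc n * (2 * X)) ≤ 2 ^ n → 2 ^ n ≤ suc n * C → b * X ≤ C
two-tails n b c₁ c₂ X C b≤c₁+c₂ tail₁ tail₂ 2^n≤[1+n]C = *-cancelˡ-≤ (2 * suc n) (begin
  2 * suc n * (b * X)                       ≡⟨ solve (n ∷ b ∷ X ∷ []) ⟩
  b * (suc n * (2 * X))                     ≤⟨ *-monoˡ-≤ K b≤c₁+c₂ ⟩
  (c₁ + c₂) * K                             ≡⟨ *-distribʳ-+ K c₁ c₂ ⟩
  c₁ * K + c₂ * K                           ≤⟨ +-mono-≤ (≤-trans tail₁ 2^n≤[1+n]C) (≤-trans tail₂ 2^n≤[1+n]C) ⟩
  suc n * C + suc n * C                     ≡⟨ solve (n ∷ C ∷ []) ⟩
  2 * suc n * C                             ∎)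
  where
  open ≤-Reasoning
  K = suc n * (2 * X)

below-next-power : ∀ n → n < 2 ^ suc ⌊log₂ n ⌋
below-next-power n = ≰⇒> λ 2^[1+log]≤n → <⇒≱ (n<1+n ⌊log₂ n ⌋)
  (subst (_≤ ⌊log₂ n ⌋) (⌊log₂[2^n]⌋≡n (suc ⌊log₂ n ⌋)) (⌊log₂⌋-mono-≤ 2^[1+log]≤n))

log-positive : ∀ n → 2 ≤ n → 1 ≤ ⌊log₂ n ⌋
log-positive n 2≤n = subst (_≤ ⌊log₂ n ⌋) (⌊log₂[2^n]⌋≡n 1) (⌊log₂⌋-mono-≤ 2≤n)

polynomial-≤-power : ∀ n A → suc n * (2 * n ^ A) ≤ 2 ^ (suc ⌊log₂ n ⌋ * (A + 2))
polynomial-≤-power n A = begin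
  suc n * (2 * n ^ A)  ≤⟨ *-mono-≤ (below-next-power n) (*-mono-≤ 2≤P (^-monoˡ-≤ A (<⇒≤ (below-next-power n)))) ⟩
  P * (P * P ^ A)      ≡⟨ *-assoc P P (P ^ A) ⟨
  P * P * P ^ A        ≡⟨ *-comm (P * P) (P ^ A) ⟩
  P ^ A * (P * P)      ≡⟨ cong (λ t → P ^ A * (P * t)) (*-identityʳ P) ⟨
  P ^ A * P ^ 2        ≡⟨ ^-distribˡ-+-* P A 2 ⟨
  P ^ (A + 2)          ≡⟨ ^-*-assoc 2 (suc ⌊log₂ n ⌋) (A + 2) ⟩
  2 ^ (suc ⌊log₂ n ⌋ * (A + 2)) ∎
  where
  open ≤-Reasoning
  P = 2 ^ suc ⌊log₂ n ⌋
  2≤P : 2 ≤ P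
  2≤P = *-monoʳ-≤ 2 (^-monoʳ-≤ 2 {0} {⌊log₂ n ⌋} z≤n)

-- The constant 144(2A + 5) absorbs the exponent E = (L + 1)(A + 2) when L ≥ 1.
log-slack : ∀ n A L → 1 ≤ L → 144 * suc (suc L * (A + 2)) * n ≤ 144 * (2 * A + 5) * n * L
log-slack n A (suc l) _ = begin
  144 * suc (suc (suc l) * (A + 2)) * n                              ≤⟨ m≤m+n _ _ ⟩
  144 * suc (suc (suc l) * (A + 2)) * n + 144 * (l * A + 3 * l) * n ≡⟨ solve (n ∷ A ∷ l ∷ []) ⟩
  144 * (2 * A + 5) * n * suc l                                      ∎
  where open ≤-Reasoning

lemma4 : (β : ℕ → ℕ)
    → (∀ n → 2 ∣ n → n < 4 * β n)
    → (∀ C → ∃ λ N → ∀ n → N ≤ n → 2 ∣ n → C * n * ⌊log₂ n ⌋ ≤ (4 * β n ∸ n) ^ 2)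
    → ∀ a → ∃ λ N → ∀ n → N ≤ n → 2 ∣ n → (S : Subset n)
    → badCount n (β n) S * n ^ a ≤ n C (n / 2)
lemma4 β n<4β spread A = N + 2 , bound
  where
  C₀ = 144 * (2 * A + 5)
  N = proj₁ (spread C₀)
  bound : ∀ n → N + 2 ≤ n → 2 ∣ n → (S : Subset n) → badCount n (β n) S * n ^ A ≤ n C (n / 2)
  bound n N+2≤n 2∣n S = two-tails n _ (count (overfull? S D) (allSubsets n))
    (count (underfull? S D) (allSubsets n)) (n ^ A) (n C (n / 2))
    (count-union _ (overfull? S D) (underfull? S D)
      (λ R disagree → disagreement⇒deviation n (β n) D S R 4β≡n+D (proj₂ disagree)) (allSubsets n))
    (proj₁ tails) (proj₂ tails) (central-binomial n 2∣n)
    where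
    D = 4 * β n ∸ n
    E = suc ⌊log₂ n ⌋ * (A + 2)
    4β≡n+D : 4 * β n ≡ n + D
    4β≡n+D = sym (m+[n∸m]≡n (<⇒≤ (n<4β n 2∣n)))
    D²-large : 144 * suc E * ∣ S ∣ ≤ D * D
    D²-large = begin
      144 * suc E * ∣ S ∣ ≤⟨ *-monoʳ-≤ (144 * suc E) (∣p∣≤n S) ⟩
      144 * suc E * n     ≤⟨ log-slack n A ⌊log₂ n ⌋ (log-positive n (≤-trans (m≤n+m 2 N) N+2≤n)) ⟩
      C₀ * n * ⌊log₂ n ⌋  ≤⟨ proj₂ (spread C₀) n (≤-trans (m≤m+n N 2) N+2≤n) 2∣n ⟩
      D ^ 2               ≡⟨ cong (D *_) (*-identityʳ D) ⟩
      D * D               ∎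
      where open ≤-Reasoning
    tails : count (overfull? S D) (allSubsets n) * (suc n * (2 * n ^ A)) ≤ 2 ^ n
          × count (underfull? S D) (allSubsets n) * (suc n * (2 * n ^ A)) ≤ 2 ^ n
    tails = deviation-counts S D E (suc n * (2 * n ^ A)) (polynomial-≤-power n A) D²-large
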